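{- Over an alphabet with as many characters as needed, the non self-referencing LZ77 factorization size satisfies $\mathsf{AS}_{\mathrm{sub}}(\mathit{z}_{77},n)=\Omega(\sqrt n)$, $\mathsf{AS}_{\mathrm{ins}}(\mathit{z}_{77},n)=\Omega(\sqrt n)$ and $\mathsf{AS}_{\mathrm{del}}(\mathit{z}_{77},n)=\Omega(\sqrt n)$.
   Context: The non self-referencing LZ77 factorization of a nonempty string $T$ is $T=f_1\cdots f_z$ defined greedily left to right: for each $i$, let $u$ be the longest prefix of the remaining suffix $f_i\cdots f_z$ that occurs as a substring of $f_1\cdots f_{i-1}$; if $u$ is the whole remaining suffix then $f_i=u$ is the last factor, otherwise $f_i=uc$ with $c$ the next character. $\mathit{z}_{77}(T)=z$. $\mathsf{ed}$ is edit distance. $\mathsf{AS}_{\mathrm{sub}}(C,n)=\sup\{C(T')-C(T):T\in\Sigma^n,T'\in\Sigma^n,\mathsf{ed}(T,T')=1\}$; $\mathsf{AS}_{\mathrm{ins}}$ the same with $T'\in\Sigma^{n+1}$, $\mathsf{AS}_{\mathrm{del}}$ with $T'\in\Sigma^{n-1}$. -}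

module Defs where

open import Data.Nat using (ℕ; zero; suc; _+_; _*_; _∸_; _≤_; _⊔_; _⊓_)
open import Data.Nat.Properties using (_≟_)
open import Data.Bool using (Bool; true; false; _∧_; _∨_; if_then_else_)
open import Data.List using (List; []; _∷_; length; take; drop; _++_)
open import Relation.Nullary.Decidable using (⌊_⌋)
open import Data.Product using (Σ; _×_; _,_; ∃-syntax)

-- Characters are natural numbers: an unbounded alphabet
-- ("as many characters as needed").
Char : Set
Char = ℕ

Str : Set
Str = List Char

_==_ : Char → Char → Bool
a == b = ⌊ a ≟ b ⌋

isPrefix : Str → Str → Bool
isPrefix []       _        = true
isPrefix (_ ∷ _)  []       = false
isPrefix (a ∷ u)  (b ∷ w)  = (a == b) ∧ isPrefix u w

occurs : Str → Str → Bool
occurs u []       = isPrefix u []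
occurs u (b ∷ w)  = isPrefix u (b ∷ w) ∨ occurs u w

longestFrom : ℕ → Str → Str → ℕ
longestFrom zero    p s = zero
longestFrom (suc k) p s =
  if occurs (take (suc k) s) p then suc k else longestFrom k p s

longestOcc : Str → Str → ℕ
longestOcc p s = longestFrom (length s) p s

-- Greedy non self-referencing LZ77 factorization.
-- Arguments: fuel, already factorized prefix f_1⋯f_{i-1}, remaining suffix.
lzFactors : ℕ → Str → Str → List Str
lzFactors _        p []       = []
lzFactors zero     p (c ∷ s)  = (c ∷ s) ∷ []   -- unreachable with enough fuel
lzFactors (suc f)  p (c ∷ s)  =
  let k = longestOcc p (c ∷ s) in
  if ⌊ k ≟ length (c ∷ s) ⌋
    then (c ∷ s) ∷ []
    else take (suc k) (c ∷ s) ∷ lzFactors f (p ++ take (suc k) (c ∷ s)) (drop (suc k) (c ∷ s))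

LZ77 : Str → List Str
LZ77 T = lzFactors (length T) [] T

z77 : Str → ℕ
z77 T = length (LZ77 T)

ed : Str → Str → ℕ
ed []       ys       = length ys
ed (x ∷ xs) []       = length (x ∷ xs)
ed (x ∷ xs) (y ∷ ys) =
  (ed xs ys + (if x == y then 0 else 1)) ⊓ suc (ed xs (y ∷ ys) ⊓ ed (x ∷ xs) ys)

module Submission where

-- Write U = 0 1 ⋯ (d-1) and let the text be U d, a separator, and then the blocks
-- B_r = r (r+1) ⋯ d for r = d-1, …, 0, each followed by a fresh separator, plus fresh padding.
-- In the text every B_r occurs inside U d, so each block together with its separator is one
-- factor. After substituting d by d+1, deleting it, or inserting d+1 before it, the letter r still
-- occurs only once before B_r, inside U, but is no longer followed there by r+1 ⋯ d; the longest
-- earlier occurrence of B_r is B_r without its last letter, so every block costs two factors and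
-- z77 grows by about d. The text has length Θ(d²), and the padding reaches every length in between.

open import Defs
open import Data.Nat
open import Data.Nat.Properties
open import Data.Bool using (true; false; _∧_)
open import Data.Bool.Properties using (∨-zeroʳ; ∨-identityʳ; ∧-zeroʳ)
open import Data.List using ([]; _∷_; length; take; drop; _++_)
open import Data.List.Properties
  using (length-++; length-++-≤ˡ; length-++-sucʳ; length-drop; ++-assoc; ++-identityʳ; ++-cancelˡ; ∷-injectiveˡ)
open import Data.List.Relation.Unary.All as All using (All; []; _∷_)
open import Data.List.Relation.Unary.All.Properties using (++⁺)
open import Data.List.Relation.Unary.AllPairs using (AllPairs; []; _∷_)
open import Data.Product using (_×_; _,_; ∃-syntax)
open import Data.Sum using (inj₁; inj₂)
open import Data.Empty using (⊥-elim)
open import Relation.Nullary using (yes; no)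
open import Relation.Binary.PropositionalEquality
open import Data.Nat.Tactic.RingSolver using (solve-∀)

==-refl : ∀ c → (c == c) ≡ true
==-refl c with c ≟ c
... | yes _ = refl
... | no c≢c = ⊥-elim (c≢c refl)

==-≢ : ∀ {c b} → c ≢ b → (c == b) ≡ false
==-≢ {c} {b} c≢b with c ≟ b
... | yes c≡b = ⊥-elim (c≢b c≡b)
... | no _ = refl

==⇒≡ : ∀ {c b} → (c == b) ≡ true → c ≡ b
==⇒≡ {c} {b} eq with c ≟ b
... | yes c≡b = c≡b

isPrefix-++ : ∀ u v → isPrefix u (u ++ v) ≡ true
isPrefix-++ []      v = refl
isPrefix-++ (a ∷ u) v rewrite ==-refl a = isPrefix-++ u v

isPrefix-++ˡ : ∀ w u v → isPrefix (w ++ u) (w ++ v) ≡ isPrefix u v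
isPrefix-++ˡ []      u v = refl
isPrefix-++ˡ (a ∷ w) u v rewrite ==-refl a = isPrefix-++ˡ w u v

isPrefix⇒occurs : ∀ u w → isPrefix u w ≡ true → occurs u w ≡ true
isPrefix⇒occurs u []      pre = pre
isPrefix⇒occurs u (b ∷ w) pre rewrite pre = refl

occurs-++ˡ : ∀ u v w → occurs u w ≡ true → occurs u (v ++ w) ≡ true
occurs-++ˡ u []      w occ = occ
occurs-++ˡ u (b ∷ v) w occ rewrite occurs-++ˡ u v w occ = ∨-zeroʳ _

occurs-infix : ∀ u v w → occurs u (v ++ u ++ w) ≡ true
occurs-infix u v w = occurs-++ˡ u v (u ++ w) (isPrefix⇒occurs u (u ++ w) (isPrefix-++ u w))

isPrefix-∉ : ∀ {c w} u v → All (c ≢_) w → isPrefix (u ++ c ∷ v) w ≡ false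
isPrefix-∉ []      v []        = refl
isPrefix-∉ []      v (c≢b ∷ _) rewrite ==-≢ c≢b = refl
isPrefix-∉ (a ∷ u) v []        = refl
isPrefix-∉ (a ∷ u) v (_ ∷ c∉w) rewrite isPrefix-∉ u v c∉w = ∧-zeroʳ _

occurs-∉ : ∀ {c w} u v → All (c ≢_) w → occurs (u ++ c ∷ v) w ≡ false
occurs-∉ u v []          = isPrefix-∉ u v []
occurs-∉ u v (c≢b ∷ c∉w) rewrite isPrefix-∉ u v (c≢b ∷ c∉w) = occurs-∉ u v c∉w

occurs-∉-++ : ∀ {c p} u q → All (c ≢_) p → occurs (c ∷ u) (p ++ q) ≡ occurs (c ∷ u) q
occurs-∉-++ u q []          = refl
occurs-∉-++ u q (c≢b ∷ c∉p) rewrite ==-≢ c≢b = occurs-∉-++ u q c∉p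

occurs-sole : ∀ {c p w} u → All (c ≢_) p → All (c ≢_) w → occurs (c ∷ u) (p ++ c ∷ w) ≡ isPrefix u w
occurs-sole {c} {p} {w} u c∉p c∉w
  rewrite occurs-∉-++ u (c ∷ w) c∉p | ==-refl c | occurs-∉ [] u c∉w = ∨-identityʳ _

isPrefix-take-mono : ∀ s w {i j} → j ≤ i → isPrefix (take i s) w ≡ true → isPrefix (take j s) w ≡ true
isPrefix-take-mono s       w       {j = zero}  _         _   = refl
isPrefix-take-mono []      w       {j = suc j} _         _   = refl
isPrefix-take-mono (a ∷ s) []      {suc i} {suc j} _     ()
isPrefix-take-mono (a ∷ s) (b ∷ w) {suc i} {suc j} (s≤s j≤i) pre with a == b
... | true  = isPrefix-take-mono s w j≤i pre
... | false = pre

occurs-take-mono : ∀ s w {i j} → j ≤ i → occurs (take i s) w ≡ true → occurs (take j s) w ≡ true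
occurs-take-mono s []      j≤i occ = isPrefix-take-mono s [] j≤i occ
occurs-take-mono s (b ∷ w) {i} j≤i occ with isPrefix (take i s) (b ∷ w) in pre
... | true  rewrite isPrefix-take-mono s (b ∷ w) j≤i pre = refl
... | false rewrite occurs-take-mono s w j≤i occ = ∨-zeroʳ _

longestFrom-≡ : ∀ p s {m} K → occurs (take m s) p ≡ true → occurs (take (suc m) s) p ≡ false →
                m ≤ K → longestFrom K p s ≡ m
longestFrom-≡ p s zero    _   _      z≤n = refl
longestFrom-≡ p s (suc K) occ ¬occ m≤1+K with m≤n⇒m<n∨m≡n m≤1+K
... | inj₂ refl rewrite occ = refl
... | inj₁ (s≤s m≤K) with occurs (take (suc K) s) p in occK
...   | true  with () ← trans (sym (occurs-take-mono s p (s≤s m≤K) occK)) ¬occ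
...   | false = longestFrom-≡ p s K occ ¬occ m≤K

record NFactors (p s : Str) (n : ℕ) : Set where
  constructor nfactors
  field factor-count : ∀ f → length s ≤ f → length (lzFactors f p s) ≡ n
open NFactors

z77-≡ : ∀ {T n} → NFactors [] T n → z77 T ≡ n
z77-≡ {T} count = factor-count count (length T) ≤-refl

count-[] : ∀ {p} → NFactors p [] 0
count-[] = nfactors λ { zero _ → refl ; (suc f) _ → refl }

count-step : ∀ {p s m n} → longestOcc p s ≡ m → m < length s →
             NFactors (p ++ take (suc m) s) (drop (suc m) s) n → NFactors p s (suc n)
count-step {s = []}                   _  ()
count-step {p} {c ∷ s} {m} {n} eq m<len count = nfactors go
  where
  go : ∀ f → length (c ∷ s) ≤ f → length (lzFactors f p (c ∷ s)) ≡ suc n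
  go (suc f) (s≤s len≤f) rewrite eq with m ≟ suc (length s)
  ... | yes refl = ⊥-elim (<-irrefl refl m<len)
  ... | no _     =
    cong suc (factor-count count f (≤-trans (≤-reflexive (length-drop m s)) (≤-trans (m∸n≤m _ m) len≤f)))

take-length-++ : ∀ (u v : Str) → take (length u) (u ++ v) ≡ u
take-length-++ []      v = refl
take-length-++ (a ∷ u) v = cong (a ∷_) (take-length-++ u v)

take-suc-length-++ : ∀ (u : Str) c r → take (suc (length u)) (u ++ c ∷ r) ≡ u ++ c ∷ []
take-suc-length-++ []      c r = refl
take-suc-length-++ (a ∷ u) c r = cong (a ∷_) (take-suc-length-++ u c r)

drop-suc-length-++ : ∀ (u : Str) c r → drop (suc (length u)) (u ++ c ∷ r) ≡ r
drop-suc-length-++ []      c r = refl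
drop-suc-length-++ (a ∷ u) c r = drop-suc-length-++ u c r

count-factor : ∀ {p u c r n} → occurs u p ≡ true → occurs (u ++ c ∷ []) p ≡ false →
               NFactors (p ++ u ++ c ∷ []) r n → NFactors p (u ++ c ∷ r) (suc n)
count-factor {p} {u} {c} {r} {n} occ ¬occ count =
  count-step longest |u|<|s|
    (subst₂ (λ w r′ → NFactors (p ++ w) r′ n)
      (sym (take-suc-length-++ u c r)) (sym (drop-suc-length-++ u c r)) count)
  where
  |u|<|s| : length u < length (u ++ c ∷ r)
  |u|<|s| = ≤-trans (s≤s (length-++-≤ˡ u)) (≤-reflexive (sym (length-++-sucʳ u c r)))
  longest : longestOcc p (u ++ c ∷ r) ≡ length u
  longest = longestFrom-≡ p (u ++ c ∷ r) _
    (subst (λ w → occurs w p ≡ true) (sym (take-length-++ u (c ∷ r))) occ)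
    (subst (λ w → occurs w p ≡ false) (sym (take-suc-length-++ u c r)) ¬occ)
    (<⇒≤ |u|<|s|)

count-fresh : ∀ {p c s n} → All (c ≢_) p → NFactors (p ++ c ∷ []) s n → NFactors p (c ∷ s) (suc n)
count-fresh {p} {c} c∉p = count-factor {u = []} (isPrefix⇒occurs [] p refl) (occurs-∉ [] [] c∉p)

count-distinct : ∀ {p v s n} → All (λ c → All (c ≢_) p) v → AllPairs _≢_ v →
                 NFactors (p ++ v) s n → NFactors p (v ++ s) (length v + n)
count-distinct {p} {[]} {s} {n} [] [] count = subst (λ q → NFactors q s n) (++-identityʳ p) count
count-distinct {p} {c ∷ v} {s} {n} (c∉p ∷ v∉p) (c∉v ∷ v-distinct) count =
  count-fresh c∉p (count-distinct (All.zipWith v∉p+c (v∉p , c∉v)) v-distinct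
    (subst (λ q → NFactors q s n) (sym (++-assoc p (c ∷ []) v)) count))
  where
  v∉p+c : ∀ {x} → All (x ≢_) p × c ≢ x → All (x ≢_) (p ++ c ∷ [])
  v∉p+c (x∉p , c≢x) = ++⁺ x∉p (≢-sym c≢x ∷ [])

run : ℕ → ℕ → Str
run a zero    = []
run a (suc m) = a ∷ run (suc a) m

length-run : ∀ a m → length (run a m) ≡ m
length-run a zero    = refl
length-run a (suc m) = cong suc (length-run (suc a) m)

run-snoc-++ : ∀ a m w → run a (suc m) ++ w ≡ run a m ++ (a + m) ∷ w
run-snoc-++ a zero    w = cong (_∷ w) (sym (+-identityʳ a))
run-snoc-++ a (suc m) w =
  cong (a ∷_) (trans (run-snoc-++ (suc a) m w) (cong (λ x → run (suc a) m ++ x ∷ w) (sym (+-suc a m))))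

All-run : ∀ {P : ℕ → Set} a m → (∀ {i} → a ≤ i → i < a + m → P i) → All P (run a m)
All-run a zero    _       = []
All-run a (suc m) P-range =
  P-range ≤-refl (m<m+n a (s≤s z≤n)) ∷
  All-run (suc a) m (λ {i} a<i i<1+a+m → P-range (<⇒≤ a<i) (subst (i <_) (sym (+-suc a m)) i<1+a+m))

run-unique : ∀ a m → AllPairs _≢_ (run a m)
run-unique a zero    = []
run-unique a (suc m) = All-run (suc a) m (λ a<i _ → <⇒≢ a<i) ∷ run-unique (suc a) m

count-run : ∀ {p a m s n} → All (_< a) p → NFactors (p ++ run a m) s n → NFactors p (run a m ++ s) (m + n)
count-run {p} {a} {m} {s} {n} p<a count =
  subst (NFactors p (run a m ++ s)) (cong (_+ n) (length-run a m))
    (count-distinct (All-run a m (λ a≤i _ → All.map (λ x<a → >⇒≢ (<-≤-trans x<a a≤i)) p<a))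
      (run-unique a m) count)

FreshTail : ℕ → Str → ℕ → Set
FreshTail b t n = ∀ {p} → All (_< b) p → NFactors p t n

run-tail : ∀ a m → FreshTail a (run a m) m
run-tail a m {p} p<a = subst₂ (NFactors p) (++-identityʳ (run a m)) (+-identityʳ m) (count-run p<a count-[])

-- The suffixes of run 0 (r + l) of lengths l+1, …, l+r, each followed by a separator s, s+1, …, s+r-1.
blocks : ℕ → ℕ → ℕ → Str → Str
blocks zero    l s t = t
blocks (suc r) l s t = run r (suc l) ++ s ∷ blocks r (suc l) (suc s) t

shift-prefix : ∀ r l q w → (run 0 (suc r) ++ run (suc r) l ++ q) ++ w ≡ run 0 r ++ run r (suc l) ++ q ++ w
shift-prefix r l q w = begin
  (run 0 (suc r) ++ run (suc r) l ++ q) ++ w   ≡⟨ ++-assoc (run 0 (suc r)) _ w ⟩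
  run 0 (suc r) ++ (run (suc r) l ++ q) ++ w   ≡⟨ cong (run 0 (suc r) ++_) (++-assoc (run (suc r) l) q w) ⟩
  run 0 (suc r) ++ run (suc r) l ++ q ++ w     ≡⟨ run-snoc-++ 0 r _ ⟩
  run 0 r ++ run r (suc l) ++ q ++ w           ∎
  where open ≡-Reasoning

occurs-next-block : ∀ r l q → occurs (run r (suc l)) (run 0 (suc r) ++ run (suc r) l ++ q) ≡ true
occurs-next-block r l q =
  subst (λ P → occurs (run r (suc l)) P ≡ true) (sym (run-snoc-++ 0 r _)) (occurs-infix (run r (suc l)) (run 0 r) q)

blocks-present : ∀ r l {s t n P} q → P ≡ run 0 r ++ run r l ++ q → r + l ≤ s → All (_< s) P →
                 FreshTail (r + s) t n → NFactors P (blocks r l s t) (r + n)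
blocks-present zero    l q _    _     P<s after = after P<s
blocks-present (suc r) l {s} {t} {n} q refl r+l≤s P<s after =
  count-factor (occurs-next-block r l q) (occurs-∉ (run r (suc l)) [] (All.map >⇒≢ P<s))
    (blocks-present r (suc l) (q ++ block) (shift-prefix r l q block) (<⇒≤ end<s) P′<s
      (subst (λ b → FreshTail b t n) (sym (+-suc r s)) after))
  where
  block : Str
  block = run r (suc l) ++ s ∷ []
  end<s : r + suc l < suc s
  end<s = s≤s (subst (_≤ s) (sym (+-suc r l)) r+l≤s)
  P′<s : All (_< suc s) ((run 0 (suc r) ++ run (suc r) l ++ q) ++ block)
  P′<s = ++⁺ (All.map m<n⇒m<1+n P<s) (++⁺ (All-run r (suc l) (λ _ i<end → <-trans i<end end<s)) (≤-refl ∷ []))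

-- The first letter of a block occurs in P only inside the run, where it is followed by z instead
-- of the block's last letter r + l; so every block costs two factors.
blocks-absent : ∀ r l {s t n P z} Z → P ≡ run 0 r ++ run r l ++ z ∷ Z → r + l < z → All (r ≤_) Z →
                r + l < s → All (_< s) P → FreshTail (r + s) t n → NFactors P (blocks r (suc l) s t) (r * 2 + n)
blocks-absent zero    l Z _    _     _   _     P<s after = after P<s
blocks-absent (suc r) l {s} {t} {n} {z = z} Z refl r+l<z r<Z r+l<s P<s after =
  subst (λ w → NFactors P w (suc r * 2 + n)) (sym (run-snoc-++ r (suc l) _))
    (count-factor (occurs-next-block r l (z ∷ Z)) block-absent
      (count-fresh (All.map >⇒≢ P+B<s)
        (blocks-absent r (suc l) (Z ++ B ++ s ∷ []) P′≡ end<z r≤Z′ end<1+s P′<s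
          (subst (λ b → FreshTail b t n) (sym (+-suc r s)) after))))
  where
  P = run 0 (suc r) ++ run (suc r) l ++ z ∷ Z
  e = r + suc l
  B = run r (suc l) ++ e ∷ []
  end<z : e < z
  end<z = subst (_< z) (sym (+-suc r l)) r+l<z
  end<s : e < s
  end<s = subst (_< s) (sym (+-suc r l)) r+l<s
  end<1+s : e < suc s
  end<1+s = m<n⇒m<1+n end<s
  r≤e : r ≤ e
  r≤e = m≤m+n r (suc l)
  block-absent : occurs B P ≡ false
  block-absent = begin
    occurs B P
      ≡⟨ cong (occurs B) (run-snoc-++ 0 r _) ⟩
    occurs (r ∷ run (suc r) l ++ e ∷ []) (run 0 r ++ r ∷ run (suc r) l ++ z ∷ Z)
      ≡⟨ occurs-sole (run (suc r) l ++ e ∷ []) (All-run 0 r (λ _ i<r → >⇒≢ i<r))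
           (++⁺ (All-run (suc r) l (λ r<i _ → <⇒≢ r<i)) (<⇒≢ (≤-<-trans r≤e end<z) ∷ All.map <⇒≢ r<Z)) ⟩
    isPrefix (run (suc r) l ++ e ∷ []) (run (suc r) l ++ z ∷ Z)
      ≡⟨ isPrefix-++ˡ (run (suc r) l) (e ∷ []) (z ∷ Z) ⟩
    (e == z) ∧ true
      ≡⟨ cong (_∧ true) (==-≢ (<⇒≢ end<z)) ⟩
    false ∎
    where open ≡-Reasoning
  P+B<s : All (_< s) (P ++ B)
  P+B<s = ++⁺ P<s (++⁺ (All-run r (suc l) (λ _ i<e → <-trans i<e end<s)) (end<s ∷ []))
  P′<s : All (_< suc s) ((P ++ B) ++ s ∷ [])
  P′<s = ++⁺ (All.map m<n⇒m<1+n P+B<s) (≤-refl ∷ [])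
  P′≡ : (P ++ B) ++ s ∷ [] ≡ run 0 r ++ run r (suc l) ++ z ∷ (Z ++ B ++ s ∷ [])
  P′≡ = trans (++-assoc P B (s ∷ [])) (shift-prefix r l (z ∷ Z) (B ++ s ∷ []))
  r≤Z′ : All (r ≤_) (Z ++ B ++ s ∷ [])
  r≤Z′ = ++⁺ (All.map <⇒≤ r<Z)
         (++⁺ (++⁺ (All-run r (suc l) (λ r≤i _ → r≤i)) (r≤e ∷ [])) (<⇒≤ (≤-<-trans r≤e end<s) ∷ []))

ed-refl : ∀ w → ed w w ≡ 0
ed-refl []       = refl
ed-refl (x ∷ xs) rewrite ==-refl x | ed-refl xs = refl

ed-++ˡ : ∀ p xs ys → ed (p ++ xs) (p ++ ys) ≤ ed xs ys
ed-++ˡ []      xs ys = ≤-refl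
ed-++ˡ (a ∷ p) xs ys rewrite ==-refl a =
  ≤-trans (m⊓n≤m _ _) (≤-trans (≤-reflexive (+-identityʳ _)) (ed-++ˡ p xs ys))

ed-substitute : ∀ a b w → ed (a ∷ w) (b ∷ w) ≤ 1
ed-substitute a b w rewrite ed-refl w with a == b
... | true  = ≤-trans (m⊓n≤m 0 (suc (ed w (b ∷ w) ⊓ ed (a ∷ w) w))) z≤n
... | false = m⊓n≤m 1 (suc (ed w (b ∷ w) ⊓ ed (a ∷ w) w))

ed-delete : ∀ a w → ed (a ∷ w) w ≤ 1
ed-delete a []       = ≤-refl
ed-delete a (y ∷ ys) = ≤-trans (m⊓n≤n _ _) (s≤s (≤-trans (m⊓n≤m _ _) (≤-reflexive (ed-refl (y ∷ ys)))))

ed-insert : ∀ a w → ed w (a ∷ w) ≤ 1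
ed-insert a []       = ≤-refl
ed-insert a (x ∷ xs) = ≤-trans (m⊓n≤n _ _) (s≤s (≤-trans (m⊓n≤n _ _) (≤-reflexive (ed-refl (x ∷ xs)))))

ed≡0⇒≡ : ∀ xs ys → ed xs ys ≡ 0 → xs ≡ ys
ed≡0⇒≡ []       []       _  = refl
ed≡0⇒≡ (x ∷ xs) (y ∷ ys) ed≡0 with ed xs ys in tail | x == y in head
... | zero  | true  = cong₂ _∷_ (==⇒≡ head) (ed≡0⇒≡ xs ys tail)
... | zero  | false with () ← ed≡0
... | suc _ | _     with () ← ed≡0

ed≡1 : ∀ xs ys → ed xs ys ≤ 1 → xs ≢ ys → ed xs ys ≡ 1
ed≡1 xs ys ed≤1 xs≢ys with ed xs ys in eq
... | zero      = ⊥-elim (xs≢ys (ed≡0⇒≡ xs ys eq))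
... | suc zero  = refl
... | suc (suc _) with s≤s () ← ed≤1

ed-substitution : ∀ u {a b} w → a ≢ b → ed (u ++ a ∷ w) (u ++ b ∷ w) ≡ 1
ed-substitution u {a} {b} w a≢b =
  ed≡1 (u ++ a ∷ w) (u ++ b ∷ w) (≤-trans (ed-++ˡ u (a ∷ w) (b ∷ w)) (ed-substitute a b w))
    (λ eq → a≢b (∷-injectiveˡ (++-cancelˡ u (a ∷ w) (b ∷ w) eq)))

ed-deletion : ∀ u a w → ed (u ++ a ∷ w) (u ++ w) ≡ 1
ed-deletion u a w =
  ed≡1 (u ++ a ∷ w) (u ++ w) (≤-trans (ed-++ˡ u (a ∷ w) w) (ed-delete a w))
    (λ eq → 1+n≢n (trans (sym (length-++-sucʳ u a w)) (cong length eq)))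

ed-insertion : ∀ u a w → ed (u ++ w) (u ++ a ∷ w) ≡ 1
ed-insertion u a w =
  ed≡1 (u ++ w) (u ++ a ∷ w) (≤-trans (ed-++ˡ u w (a ∷ w)) (ed-insert a w))
    (λ eq → 1+n≢n (trans (sym (length-++-sucʳ u a w)) (cong length (sym eq))))

z77-run-++ : ∀ {d} v {s n} → All (d ≤_) v → AllPairs _≢_ v → NFactors (run 0 d ++ v) s n →
             z77 (run 0 d ++ v ++ s) ≡ d + (length v + n)
z77-run-++ {d} v d≤v v-distinct count =
  z77-≡ (count-run [] (count-distinct (All.map v∉run d≤v) v-distinct count))
  where
  v∉run : ∀ {c} → d ≤ c → All (c ≢_) (run 0 d)
  v∉run d≤c = All-run 0 d (λ _ i<d → >⇒≢ (<-≤-trans i<d d≤c))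

run-++<3+d : ∀ d {v} → All (_< 3 + d) v → All (_< 3 + d) (run 0 d ++ v)
run-++<3+d d = ++⁺ (All-run 0 d (λ _ i<d → <-≤-trans i<d (m≤n+m d 3)))

-- Characters: the run 0 … d-1, then d (changed to suc d by the edits), the separator 2+d,
-- the block separators 3+d … 2d+2 and the padding from 2d+3 on.
padded-blocks : ℕ → ℕ → Str
padded-blocks d m = blocks d 1 (3 + d) (run (d + (3 + d)) m)

rest : ℕ → ℕ → Str
rest d m = suc (suc d) ∷ padded-blocks d m

text substituted deleted inserted : ℕ → ℕ → Str
text        d m = run 0 d ++ d ∷ rest d m
substituted d m = run 0 d ++ suc d ∷ rest d m
deleted     d m = run 0 d ++ rest d m
inserted    d m = run 0 d ++ suc d ∷ d ∷ rest d m

z77-altered : ∀ d z Z m → d < z → All (d ≤_) Z → AllPairs _≢_ (z ∷ Z) → All (_< 3 + d) (z ∷ Z) →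
              z77 (run 0 d ++ (z ∷ Z) ++ padded-blocks d m) ≡ d + (suc (length Z) + (d * 2 + m))
z77-altered d z Z m d<z d≤Z distinct Z<3+d =
  z77-run-++ (z ∷ Z) (<⇒≤ d<z ∷ d≤Z) distinct
    (blocks-absent d 0 Z refl (subst (_< z) (sym (+-identityʳ d)) d<z) d≤Z
      (subst (_< 3 + d) (sym (+-identityʳ d)) (m<n+m d (s≤s z≤n))) (run-++<3+d d Z<3+d) (run-tail _ m))

module _ (d m : ℕ) where
  private
    d<1+d : d < 1 + d
    d<1+d = n<1+n d
    1+d<2+d : 1 + d < 2 + d
    1+d<2+d = n<1+n (suc d)
    2+d<3+d : 2 + d < 3 + d
    2+d<3+d = n<1+n (suc (suc d))
    d<2+d : d < 2 + d
    d<2+d = <-trans d<1+d 1+d<2+d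

  z77-text : z77 (text d m) ≡ d + (2 + (d + m))
  z77-text =
    z77-run-++ (d ∷ suc (suc d) ∷ []) (≤-refl ∷ <⇒≤ d<2+d ∷ []) ((<⇒≢ d<2+d ∷ []) ∷ [] ∷ [])
      (blocks-present d 1 (suc (suc d) ∷ []) refl
        (subst (_≤ 3 + d) (+-comm 1 d) (<⇒≤ (<-trans 1+d<2+d 2+d<3+d)))
        (run-++<3+d d (<-trans d<2+d 2+d<3+d ∷ 2+d<3+d ∷ [])) (run-tail _ m))

  z77-substituted : z77 (substituted d m) ≡ d + (2 + (d * 2 + m))
  z77-substituted =
    z77-altered d (suc d) (suc (suc d) ∷ []) m d<1+d (<⇒≤ d<2+d ∷ [])
      ((<⇒≢ 1+d<2+d ∷ []) ∷ [] ∷ []) (<-trans 1+d<2+d 2+d<3+d ∷ 2+d<3+d ∷ [])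

  z77-deleted : z77 (deleted d m) ≡ d + (1 + (d * 2 + m))
  z77-deleted = z77-altered d (suc (suc d)) [] m d<2+d [] ([] ∷ []) (2+d<3+d ∷ [])

  z77-inserted : z77 (inserted d m) ≡ d + (3 + (d * 2 + m))
  z77-inserted =
    z77-altered d (suc d) (d ∷ suc (suc d) ∷ []) m d<1+d (≤-refl ∷ <⇒≤ d<2+d ∷ [])
      ((>⇒≢ d<1+d ∷ <⇒≢ 1+d<2+d ∷ []) ∷ (<⇒≢ d<2+d ∷ []) ∷ [] ∷ [])
      (<-trans 1+d<2+d 2+d<3+d ∷ <-trans d<2+d 2+d<3+d ∷ 2+d<3+d ∷ [])

  length-substituted : length (substituted d m) ≡ length (text d m)
  length-substituted = trans (length-++ (run 0 d)) (sym (length-++ (run 0 d)))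

  length-inserted : length (inserted d m) ≡ suc (length (text d m))
  length-inserted = length-++-sucʳ (run 0 d) (suc d) (d ∷ rest d m)

  length-deleted : suc (length (deleted d m)) ≡ length (text d m)
  length-deleted = sym (length-++-sucʳ (run 0 d) d (rest d m))

  ed-substituted : ed (text d m) (substituted d m) ≡ 1
  ed-substituted = ed-substitution (run 0 d) (rest d m) (<⇒≢ d<1+d)

  ed-inserted : ed (text d m) (inserted d m) ≡ 1
  ed-inserted = ed-insertion (run 0 d) (suc d) (d ∷ rest d m)

  ed-deleted : ed (text d m) (deleted d m) ≡ 1
  ed-deleted = ed-deletion (run 0 d) d (rest d m)

∸-≡ : ∀ {x y a} g → x ≡ a → y ≡ a + g → y ∸ x ≡ g
∸-≡ {a = a} g refl refl = m+n∸m≡n a g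

gain-substituted : ∀ d m → z77 (substituted d m) ∸ z77 (text d m) ≡ d
gain-substituted d m = ∸-≡ d (z77-text d m) (trans (z77-substituted d m) (arith d m))
  where
  arith : ∀ d m → d + (2 + (d * 2 + m)) ≡ d + (2 + (d + m)) + d
  arith = solve-∀

gain-deleted : ∀ e m → z77 (deleted (suc e) m) ∸ z77 (text (suc e) m) ≡ e
gain-deleted e m = ∸-≡ e (z77-text (suc e) m) (trans (z77-deleted (suc e) m) (arith e m))
  where
  arith : ∀ e m → suc e + (1 + (suc e * 2 + m)) ≡ suc e + (2 + (suc e + m)) + e
  arith = solve-∀

gain-inserted : ∀ d m → z77 (inserted d m) ∸ z77 (text d m) ≡ suc d
gain-inserted d m = ∸-≡ (suc d) (z77-text d m) (trans (z77-inserted d m) (arith d m))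
  where
  arith : ∀ d m → d + (3 + (d * 2 + m)) ≡ d + (2 + (d + m)) + suc d
  arith = solve-∀

blocks-++ : ∀ r l s t → blocks r l s t ≡ blocks r l s [] ++ t
blocks-++ zero    l s t = refl
blocks-++ (suc r) l s t =
  trans (cong (λ x → run r (suc l) ++ s ∷ x) (blocks-++ r (suc l) (suc s) t))
        (sym (++-assoc (run r (suc l)) (s ∷ blocks r (suc l) (suc s) []) t))

length-blocks : ∀ r l s → length (blocks r l s []) ≤ r * (r + l + 1)
length-blocks zero    l s = z≤n
length-blocks (suc r) l s = begin
  length (run r (suc l) ++ s ∷ blocks r (suc l) (suc s) [])
    ≡⟨ length-++ (run r (suc l)) ⟩
  length (run r (suc l)) + suc (length (blocks r (suc l) (suc s) []))
    ≡⟨ cong (_+ suc (length (blocks r (suc l) (suc s) []))) (length-run r (suc l)) ⟩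
  suc l + suc (length (blocks r (suc l) (suc s) []))
    ≤⟨ +-monoʳ-≤ (suc l) (s≤s (length-blocks r (suc l) (suc s))) ⟩
  suc l + suc (r * (r + suc l + 1))
    ≤⟨ m≤m+n _ r ⟩
  suc l + suc (r * (r + suc l + 1)) + r
    ≡⟨ arith r l ⟩
  suc r * (suc r + l + 1) ∎
  where
  open ≤-Reasoning
  arith : ∀ r l → suc l + suc (r * (r + suc l + 1)) + r ≡ suc r * (suc r + l + 1)
  arith = solve-∀

textLength : ℕ → ℕ
textLength d = length (text d 0)

length-text : ∀ d m → length (text d m) ≡ textLength d + m
length-text d m = begin
  length (text d m)
    ≡⟨ cong (λ x → length (run 0 d ++ d ∷ suc (suc d) ∷ x)) (blocks-++ d 1 (3 + d) _) ⟩
  length (run 0 d ++ d ∷ suc (suc d) ∷ blocks d 1 (3 + d) [] ++ pad)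
    ≡⟨ cong length (sym (++-assoc (run 0 d) _ pad)) ⟩
  length (text d 0 ++ pad)
    ≡⟨ length-++ (text d 0) ⟩
  textLength d + length pad
    ≡⟨ cong (textLength d +_) (length-run _ m) ⟩
  textLength d + m ∎
  where
  open ≡-Reasoning
  pad = run (d + (3 + d)) m

d≤textLength : ∀ d → d ≤ textLength d
d≤textLength d = subst (_≤ textLength d) (length-run 0 d) (length-++-≤ˡ (run 0 d))

textLength-bound : ∀ k → textLength (3 + k) ≤ 20 * (suc k * suc k)
textLength-bound k = begin
  textLength d
    ≡⟨ length-++ (run 0 d) ⟩
  length (run 0 d) + (2 + length (blocks d 1 (3 + d) []))
    ≡⟨ cong (_+ (2 + length (blocks d 1 (3 + d) []))) (length-run 0 d) ⟩
  d + (2 + length (blocks d 1 (3 + d) []))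
    ≤⟨ +-monoʳ-≤ d (+-monoʳ-≤ 2 (length-blocks d 1 (3 + d))) ⟩
  d + (2 + d * (d + 1 + 1))
    ≤⟨ m≤m+n _ (19 * k * k + 31 * k) ⟩
  d + (2 + d * (d + 1 + 1)) + (19 * k * k + 31 * k)
    ≡⟨ arith k ⟩
  20 * (suc k * suc k) ∎
  where
  open ≤-Reasoning
  d = 3 + k
  arith : ∀ k → 3 + k + (2 + (3 + k) * (3 + k + 1 + 1)) + (19 * k * k + 31 * k) ≡ 20 * (suc k * suc k)
  arith = solve-∀

crossing : ∀ (f : ℕ → ℕ) {n} j → f 0 ≤ n → n < f (suc j) → ∃[ k ] (f k ≤ n × n < f (suc k))
crossing f zero    f0≤n n<f1 = 0 , f0≤n , n<f1
crossing f {n} (suc j) f0≤n n<f with f (suc j) ≤? n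
... | yes fj≤n = suc j , fj≤n , n<f
... | no  fj≰n = crossing f j f0≤n (≰⇒> fj≰n)

text-of-length : ∀ n → textLength 2 ≤ n →
                 ∃[ k ] ∃[ m ] (length (text (2 + k) m) ≡ n × n ≤ 20 * (suc k * suc k))
text-of-length n n₀≤n
  with crossing (λ k → textLength (2 + k)) n n₀≤n (<-≤-trans (m<n+m n (s≤s z≤n)) (d≤textLength (3 + n)))
... | k , short≤n , n<long =
  k , n ∸ textLength (2 + k) , trans (length-text (2 + k) _) (m+[n∸m]≡n short≤n) ,
  ≤-trans (<⇒≤ n<long) (textLength-bound k)

square-mono : ∀ C {n k g} → n ≤ C * (k * k) → k ≤ g → n ≤ C * (g * g)
square-mono C n≤ k≤g = ≤-trans n≤ (*-monoʳ-≤ C (*-mono-≤ k≤g k≤g))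

theorem13 :
    (∃[ C ] ∃[ n₀ ] ((n : ℕ) → n₀ ≤ n →
       ∃[ T ] ∃[ T' ] (length T ≡ n × length T' ≡ n × ed T T' ≡ 1 ×
         n ≤ C * ((z77 T' ∸ z77 T) * (z77 T' ∸ z77 T))))) ×
    (∃[ C ] ∃[ n₀ ] ((n : ℕ) → n₀ ≤ n →
       ∃[ T ] ∃[ T' ] (length T ≡ n × length T' ≡ suc n × ed T T' ≡ 1 ×
         n ≤ C * ((z77 T' ∸ z77 T) * (z77 T' ∸ z77 T))))) ×
    (∃[ C ] ∃[ n₀ ] ((n : ℕ) → n₀ ≤ n →
       ∃[ T ] ∃[ T' ] (length T ≡ n × suc (length T') ≡ n × ed T T' ≡ 1 ×
         n ≤ C * ((z77 T' ∸ z77 T) * (z77 T' ∸ z77 T)))))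
theorem13 =
  (20 , textLength 2 , λ n n₀≤n → let k , m , |T|≡n , n≤ = text-of-length n n₀≤n in
     text (2 + k) m , substituted (2 + k) m ,
     |T|≡n , trans (length-substituted (2 + k) m) |T|≡n , ed-substituted (2 + k) m ,
     square-mono 20 n≤ (≤-trans (n≤1+n _) (≤-reflexive (sym (gain-substituted (2 + k) m))))) ,
  (20 , textLength 2 , λ n n₀≤n → let k , m , |T|≡n , n≤ = text-of-length n n₀≤n in
     text (2 + k) m , inserted (2 + k) m ,
     |T|≡n , trans (length-inserted (2 + k) m) (cong suc |T|≡n) , ed-inserted (2 + k) m ,
     square-mono 20 n≤ (≤-trans (m≤n+m _ 2) (≤-reflexive (sym (gain-inserted (2 + k) m))))) ,
  (20 , textLength 2 , λ n n₀≤n → let k , m , |T|≡n , n≤ = text-of-length n n₀≤n in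
     text (2 + k) m , deleted (2 + k) m ,
     |T|≡n , trans (length-deleted (2 + k) m) |T|≡n , ed-deleted (2 + k) m ,
     square-mono 20 n≤ (≤-reflexive (sym (gain-deleted (suc k) m))))
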